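{- Let $f,g$ be systems with $\mathrm{Comp}(f)=\mathrm{Comp}(g)=:C$, fix a valuation $\mathcal{V}$, and assume $V(C):=\bigcup_{c\in C}Var(c)$ is finite. For any $(x,y)\in\mathrm{Beh}(f)\times\mathrm{Beh}(g)$: (a) $f,\mathcal{V},x\models\varphi\iff g,\mathcal{V},y\models\varphi$ for all $\varphi\in\mathcal{L}(C)$ if and only if $\mathsf{tp}(x)=\mathsf{tp}(y)$; (b) $f,\mathcal{V},x\models\varphi\iff g,\mathcal{V},y\models\varphi$ for all $\varphi\in\mathcal{L}(C)^\Box$ if and only if $\mathsf{tp}(x)=\mathsf{tp}(y)$ and $\mathsf{tps}(f)=\mathsf{tps}(g)$.
   Context: Fix a collection $\mathbb{C}$ of basic components with behaviour sets $\mathrm{Beh}(c)$; for nonempty $C\subseteq\mathbb{C}$, $\mathrm{Beh}(C)=\prod_{c\in C}\mathrm{Beh}(c)$. A system is a function $f:B\to\mathrm{Beh}(C)$, $\mathrm{Beh}(f):=B$, $\mathrm{Comp}(f):=C$, with $f_c$ the composite with the projection to $\mathrm{Beh}(c)$. Each $c$ has pairwise disjoint variable sets $Var(c)$; a valuation $\mathcal{V}$ sends $p\in Var(c)$ to a subset of $\mathrm{Beh}(c)$. $\mathcal{L}(C)$: formulas from variables in $V(C)$ with $\land,\lnot$; $\mathcal{L}(C)^\Box$ additionally allows a unary $\Box$. Interpretation at $(f,\mathcal{V},x)$, $\mathrm{Comp}(f)\supseteq C$, $x\in\mathrm{Beh}(f)$: $f,\mathcal{V},x\models p$ iff $f_c(x)\in\mathcal{V}(p)$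 ($p\in Var(c)$); $\land,\lnot$ classical; $f,\mathcal{V},x\models\Box\varphi$ iff $f,\mathcal{V},y\models\varphi$ for all $y\in\mathrm{Beh}(f)$. For a system $f$ with $\mathrm{Comp}(f)=C$ and $x\in\mathrm{Beh}(f)$, $\mathsf{tp}(x):=\{p\in V(C)\mid f,\mathcal{V},x\models p\}$ and $\mathsf{tps}(f):=\{\mathsf{tp}(x)\mid x\in\mathrm{Beh}(f)\}$. -}

module Defs where

open import Data.Bool using (Bool; true; false)
open import Data.Product using (Σ; _×_; _,_; ∃)
open import Relation.Nullary using (¬_)
open import Function.Bundles using (_⇔_)

-- V(C) = ⋃_{c ∈ C} Var(c) is rendered as the disjoint sum Σ C Var
-- (the Var(c) are pairwise disjoint by assumption).
module _ (C : Set) (Beh : C → Set) (Var : C → Set) where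

  VarC : Set
  VarC = Σ C Var

  BehC : Set
  BehC = (c : C) → Beh c

  System : Set → Set
  System B = B → BehC

  Valuation : Set₁
  Valuation = (c : C) → Var c → Beh c → Set

  -- Formulas. Fm false = 𝓛(C) (variables, ∧, ¬);
  -- Fm true = 𝓛(C)^□ (additionally □).
  data Fm : Bool → Set where
    var  : ∀ {b} → VarC → Fm b
    _∧'_ : ∀ {b} → Fm b → Fm b → Fm b
    ¬'_  : ∀ {b} → Fm b → Fm b
    □_   : Fm true → Fm true

  Sat : ∀ {B : Set} → System B → Valuation → B → ∀ {b} → Fm b → Set
  Sat f 𝓥 x (var (c , p)) = 𝓥 c p (f x c)
  Sat f 𝓥 x (φ ∧' ψ)      = Sat f 𝓥 x φ × Sat f 𝓥 x ψ
  Sat f 𝓥 x (¬' φ)        = ¬ Sat f 𝓥 x φ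
  Sat {B} f 𝓥 x (□ φ)     = (y : B) → Sat f 𝓥 y φ

  tp : ∀ {B : Set} → System B → Valuation → B → VarC → Set
  tp f 𝓥 x (c , p) = 𝓥 c p (f x c)

  _≐_ : (VarC → Set) → (VarC → Set) → Set
  P ≐ Q = (v : VarC) → P v ⇔ Q v

  TpsEq : ∀ {B B' : Set} → System B → System B' → Valuation → Set
  TpsEq {B} {B'} f g 𝓥 =
    ((x : B) → ∃ λ (y : B') → tp f 𝓥 x ≐ tp g 𝓥 y) ×
    ((y : B') → ∃ λ (x : B) → tp f 𝓥 x ≐ tp g 𝓥 y)

-- A type tp(x) is pinned down by the □-free formulas, since a literal ±p is
-- one. With □, the characteristic formula χ(x') of any x' ∈ Beh(f) (the
-- conjunction of the literals true at x', finite because V(C) is) gives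
-- ◇χ(x') = ¬□¬χ(x'), which holds everywhere in f; if it also holds at y in g,
-- classically some y' ∈ Beh(g) satisfies χ(x'), i.e. tp(y') = tp(x').
-- Conversely, induction on formulas: equal types settle atoms, and
-- tps(f) = tps(g) lets □ be transported between f and g.
module Submission where

open import Defs
open import Data.Bool using (Bool; true; false)
open import Data.Nat using (ℕ; zero; suc)
open import Data.Fin using (Fin; zero; suc)
open import Data.Fin.Properties using (¬Fin0; ∀-cons; ∀-cons-⇔)
open import Data.Empty using (⊥-elim)
open import Data.Product using (Σ; _×_; _,_; ∃-syntax; map₂)
open import Data.Product.Function.NonDependent.Propositional using (_×-⇔_)
open import Function.Base using (_∘_; _$_)
open import Function.Bundles using (_⇔_; _↔_; mk⇔; Inverse; Equivalence)
import Function.Properties.Equivalence as ⇔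
open import Function.Related.TypeIsomorphisms using (¬-cong-⇔)
open import Level using (0ℓ)
open import Axiom.ExcludedMiddle using (ExcludedMiddle)
open import Axiom.DoubleNegationElimination using (em⇒dne)
open import Relation.Nullary using (Dec; yes; no)
open import Relation.Binary.PropositionalEquality using (subst)

module _ {C : Set} {Beh : C → Set} {Var : C → Set} (𝓥 : Valuation C Beh Var) where

  open Equivalence using (to; from)

  Formula : Bool → Set
  Formula = Fm C Beh Var

  infix 4 _⊨[_]_
  _⊨[_]_ : ∀ {B b} → System C Beh Var B → B → Formula b → Set
  f ⊨[ x ] φ = Sat C Beh Var f 𝓥 x φ

  SameType : ∀ {B B'} → System C Beh Var B → B → System C Beh Var B' → B' → Set
  SameType f x g y = _≐_ C Beh Var (tp C Beh Var f 𝓥 x) (tp C Beh Var g 𝓥 y)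

  SameTypes : ∀ {B B'} → System C Beh Var B → System C Beh Var B' → Set
  SameTypes f g = TpsEq C Beh Var f g 𝓥

  Equivalent : ∀ {B B'} → Bool → System C Beh Var B → B → System C Beh Var B' → B' → Set
  Equivalent b f x g y = (φ : Formula b) → f ⊨[ x ] φ ⇔ g ⊨[ y ] φ

  SameType-sym : ∀ {B B'} (f : System C Beh Var B) (g : System C Beh Var B') {x y} →
    SameType f x g y → SameType g y f x
  SameType-sym f g same v = ⇔.sym (same v)

  Equivalent⇒SameType : ∀ {B B' b} (f : System C Beh Var B) (g : System C Beh Var B') {x y} →
    Equivalent b f x g y → SameType f x g y
  Equivalent⇒SameType f g agree (c , p) = agree (var (c , p))

  SameType⇒Equivalent : ∀ {B B'} (f : System C Beh Var B) (g : System C Beh Var B') {x y} →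
    SameType f x g y → Equivalent false f x g y
  SameType⇒Equivalent f g same (var (c , p)) = same (c , p)
  SameType⇒Equivalent f g same (φ ∧' ψ) =
    SameType⇒Equivalent f g same φ ×-⇔ SameType⇒Equivalent f g same ψ
  SameType⇒Equivalent f g same (¬' φ) = ¬-cong-⇔ (SameType⇒Equivalent f g same φ)

  SameType×SameTypes⇒Equivalent□ : ∀ {B B'} (f : System C Beh Var B) (g : System C Beh Var B') →
    SameTypes f g → ∀ {x y} → SameType f x g y → Equivalent true f x g y
  SameType×SameTypes⇒Equivalent□ f g tps same (var (c , p)) = same (c , p)
  SameType×SameTypes⇒Equivalent□ f g tps same (φ ∧' ψ) =
    SameType×SameTypes⇒Equivalent□ f g tps same φ
      ×-⇔ SameType×SameTypes⇒Equivalent□ f g tps same ψ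
  SameType×SameTypes⇒Equivalent□ f g tps same (¬' φ) =
    ¬-cong-⇔ (SameType×SameTypes⇒Equivalent□ f g tps same φ)
  SameType×SameTypes⇒Equivalent□ f g (forth , back) same (□ φ) = mk⇔
    (λ all y' → let (x' , same') = back y' in to (recurse same') (all x'))
    (λ all x' → let (y' , same') = forth x' in from (recurse same') (all y'))
    where
    recurse : ∀ {x' y'} → SameType f x' g y' → f ⊨[ x' ] φ ⇔ g ⊨[ y' ] φ
    recurse same' = SameType×SameTypes⇒Equivalent□ f g (forth , back) same' φ

  literal : ∀ {b} {P : Set} → Dec P → VarC C Beh Var → Formula b
  literal (yes _) v = var v
  literal (no _)  v = ¬' var v

  ⊨-literal : ∀ {B b} (f : System C Beh Var B) x v (d : Dec (tp C Beh Var f 𝓥 x v)) →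
    f ⊨[ x ] literal {b} d v
  ⊨-literal f x (c , p) (yes holds) = holds
  ⊨-literal f x (c , p) (no fails)  = fails

  ⊨-literal⇒agree : ∀ {B B' b} (f : System C Beh Var B) (g : System C Beh Var B') x y v
    (d : Dec (tp C Beh Var f 𝓥 x v)) → g ⊨[ y ] literal {b} d v →
    tp C Beh Var f 𝓥 x v ⇔ tp C Beh Var g 𝓥 y v
  ⊨-literal⇒agree f g x y (c , p) (yes holds) holds' = mk⇔ (λ _ → holds') (λ _ → holds)
  ⊨-literal⇒agree f g x y (c , p) (no fails)  fails' = mk⇔ (⊥-elim ∘ fails) (⊥-elim ∘ fails')

  -- Only nonempty conjunctions: without a variable to hand there is no ⊤.
  ⋀ : ∀ {n b} → (Fin (suc n) → Formula b) → Formula b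
  ⋀ {zero}  F = F zero
  ⋀ {suc n} F = F zero ∧' ⋀ (F ∘ suc)

  ⊨-⋀ : ∀ {B b n} (f : System C Beh Var B) x (F : Fin (suc n) → Formula b) →
    f ⊨[ x ] ⋀ F ⇔ (∀ i → f ⊨[ x ] F i)
  ⊨-⋀ {n = zero}  f x F = mk⇔ (λ holds → ∀-cons holds λ ()) (_$ zero)
  ⊨-⋀ {n = suc n} f x F = ⇔.trans (⇔.refl ×-⇔ ⊨-⋀ f x (F ∘ suc)) ∀-cons-⇔

  infix 5 ◇_
  ◇_ : Formula true → Formula true
  ◇ φ = ¬' □ ¬' φ

  ⊨-◇ : ExcludedMiddle 0ℓ → ∀ {B} (f : System C Beh Var B) x (φ : Formula true) →
    f ⊨[ x ] ◇ φ ⇔ (∃[ y ] f ⊨[ y ] φ)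
  ⊨-◇ em f x φ = mk⇔
    (λ possible → em⇒dne em λ nowhere → possible λ y holds → nowhere (y , holds))
    (λ (y , holds) everywhere-not → everywhere-not y holds)

  module _ (em : ExcludedMiddle 0ℓ) {n} (enum : VarC C Beh Var ↔ Fin (suc n)) where

    open Inverse enum using (strictlyInverseʳ) renaming (to to index; from to nth)

    characteristic : ∀ {B} → System C Beh Var B → B → Formula true
    characteristic f x = ⋀ λ i → literal (em {tp C Beh Var f 𝓥 x (nth i)}) (nth i)

    ⊨-characteristic : ∀ {B} (f : System C Beh Var B) x → f ⊨[ x ] characteristic f x
    ⊨-characteristic f x = from (⊨-⋀ f x _) λ i → ⊨-literal f x (nth i) em

    ⊨-characteristic⇒SameType : ∀ {B B'} (f : System C Beh Var B) (g : System C Beh Var B') x y →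
      g ⊨[ y ] characteristic f x → SameType f x g y
    ⊨-characteristic⇒SameType f g x y holds v =
      subst (λ u → tp C Beh Var f 𝓥 x u ⇔ tp C Beh Var g 𝓥 y u) (strictlyInverseʳ v)
        (⊨-literal⇒agree f g x y (nth (index v)) em (to (⊨-⋀ g y _) holds (index v)))

  ⊨-preserved⇒types-realised : ExcludedMiddle 0ℓ → ∀ {n} → VarC C Beh Var ↔ Fin n →
    ∀ {B B'} (f : System C Beh Var B) (g : System C Beh Var B') {x y} →
    ((φ : Formula true) → f ⊨[ x ] φ → g ⊨[ y ] φ) →
    ∀ x' → ∃[ y' ] SameType f x' g y'
  ⊨-preserved⇒types-realised em {zero} enum f g {y = y} _ x' =
    y , ⊥-elim ∘ ¬Fin0 ∘ Inverse.to enum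
  ⊨-preserved⇒types-realised em {suc n} enum f g {x} {y} preserved x' =
    let y' , holds = to (⊨-◇ em g y χ)
          (preserved (◇ χ) (from (⊨-◇ em f x χ) (x' , ⊨-characteristic em enum f x')))
    in y' , ⊨-characteristic⇒SameType em enum f g x' y' holds
    where χ = characteristic em enum f x'

  Equivalent□⇒SameTypes : ExcludedMiddle 0ℓ → ∀ {n} → VarC C Beh Var ↔ Fin n →
    ∀ {B B'} (f : System C Beh Var B) (g : System C Beh Var B') {x y} →
    Equivalent true f x g y → SameTypes f g
  Equivalent□⇒SameTypes em enum f g agree =
    ⊨-preserved⇒types-realised em enum f g (to ∘ agree) ,
    map₂ (SameType-sym g f) ∘ ⊨-preserved⇒types-realised em enum g f (from ∘ agree)

theorem6 : ExcludedMiddle 0ℓ →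
    (C : Set) (Beh : C → Set) (Var : C → Set) → C →
    Σ ℕ (λ n → VarC C Beh Var ↔ Fin n) →
    {B B' : Set} (f : System C Beh Var B) (g : System C Beh Var B')
    (𝓥 : Valuation C Beh Var) (x : B) (y : B') →
    (((φ : Fm C Beh Var false) → Sat C Beh Var f 𝓥 x φ ⇔ Sat C Beh Var g 𝓥 y φ)
      ⇔ _≐_ C Beh Var (tp C Beh Var f 𝓥 x) (tp C Beh Var g 𝓥 y))
    ×
    (((φ : Fm C Beh Var true) → Sat C Beh Var f 𝓥 x φ ⇔ Sat C Beh Var g 𝓥 y φ)
      ⇔ (_≐_ C Beh Var (tp C Beh Var f 𝓥 x) (tp C Beh Var g 𝓥 y)
          × TpsEq C Beh Var f g 𝓥))
theorem6 em C Beh Var _ (n , enum) f g 𝓥 x y =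
  mk⇔ (Equivalent⇒SameType 𝓥 f g) (SameType⇒Equivalent 𝓥 f g) ,
  mk⇔ (λ agree → Equivalent⇒SameType 𝓥 f g agree , Equivalent□⇒SameTypes 𝓥 em enum f g agree)
      (λ (same , tps) → SameType×SameTypes⇒Equivalent□ 𝓥 f g tps same)
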